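{- Let $\mathcal{N}=\mathbb{N}^{\mathbb{N}}$ be the Baire space and let $X=\{\alpha\in\mathcal{N} : \alpha(0)>0\}$. If $E\subseteq X\times X$ is an analytic ($\boldsymbol{\Sigma}^1_1$) equivalence relation on $X$, then there is a closed, reflexive, symmetric relation $R\subseteq\mathcal{N}\times\mathcal{N}$ such that $E=\operatorname{tc}(R)\cap(X\times X)$.
   Context: $\mathcal{N}=\mathbb{N}^{\mathbb{N}}$ carries the product topology of discrete spaces, and $R$ is reflexive on $\mathcal{N}$. For a relation $R$, $R^{(1)}=R$, $R^{(n+1)}=R\circ R^{(n)}$, and the transitive closure is $\operatorname{tc}(R)=\bigcup_{n\ge1}R^{(n)}$. -}

module Defs where

open import Data.Nat using (ℕ; zero; suc; _<_)
open import Data.Product using (Σ; ∃; _×_; _,_)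
open import Relation.Binary.PropositionalEquality using (_≡_)
open import Relation.Nullary using (¬_)

Baire : Set
Baire = ℕ → ℕ

Agree : ℕ → Baire → Baire → Set
Agree n α β = ∀ i → i < n → α i ≡ β i

InX : Baire → Set
InX α = 0 < α 0

Rel₂ : Set₁
Rel₂ = Baire → Baire → Set

Rel₃ : Set₁
Rel₃ = Baire → Baire → Baire → Set

Closed₂ : Rel₂ → Set
Closed₂ R = ∀ α β →
  (∀ n → Σ Baire λ α' → Σ Baire λ β' → Agree n α α' × Agree n β β' × R α' β') →
  R α β

Closed₃ : Rel₃ → Set
Closed₃ F = ∀ α β γ →
  (∀ n → Σ Baire λ α' → Σ Baire λ β' → Σ Baire λ γ' →
     Agree n α α' × Agree n β β' × Agree n γ γ' × F α' β' γ') →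
  F α β γ

Analytic₂ : Rel₂ → Set₁
Analytic₂ E = Σ Rel₃ λ F → Closed₃ F × (∀ α β → (E α β → ∃ λ γ → F α β γ) × ((∃ λ γ → F α β γ) → E α β))

EquivOnX : Rel₂ → Set
EquivOnX E =
  (∀ α β → E α β → InX α × InX β) ×
  (∀ α → InX α → E α α) ×
  (∀ α β → E α β → E β α) ×
  (∀ α β γ → E α β → E β γ → E α γ)

Reflexive₂ : Rel₂ → Set
Reflexive₂ R = ∀ α → R α α

Symmetric₂ : Rel₂ → Set
Symmetric₂ R = ∀ α β → R α β → R β α

_∘R_ : Rel₂ → Rel₂ → Rel₂
(R ∘R S) α γ = ∃ λ β → S α β × R β γ

-- RPow R n = R^(n+1):  R^(1) = R,  R^(n+1) = R ∘ R^(n)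
RPow : Rel₂ → ℕ → Rel₂
RPow R zero = R
RPow R (suc n) = R ∘R RPow R n

tc : Rel₂ → Rel₂
tc R α β = ∃ λ n → RPow R n α β

module Submission where

-- Write E as the projection of a closed F ⊆ 𝒩³.  Points outside X
-- (those with α(0) = 0) are used as *codes*: a code carries a tag α(1) (zero for a
-- left code, nonzero for a right code) and, interleaved in the remaining
-- coordinates, a triple (α₀, α₁, γ).  The closed relation R is defined piecewise
-- according to the kinds (point of X / left code / right code) of its arguments:
-- a point α is R-related to a left (right) code c iff c codes a triple in F whose
-- first (second) component is α, a left and a right code are related iff they
-- carry the same triple and that triple lies in F, and otherwise R is equality.
-- Then E(α, β) with witness γ gives the chain  α R cₗ R cᵣ R β  through the two
-- codes of (α, β, γ); conversely an invariant ("this point represents a point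
-- E-equivalent to α") is preserved along every R-step, so tc(R) ∩ X² ⊆ E.
-- Separate left and right codes are needed because R must be a finite
-- intersection of closed conditions in each case: relating α to a single code
-- whose first *or* second component is α would be a union, whose closedness
-- is not constructively available.

open import Defs
open import Data.Product using (Σ; ∃; _×_; _,_; proj₁; proj₂)
open import Data.Nat using (ℕ; zero; suc; _+_; _*_; _≤_; z≤n; s≤s)
open import Data.Nat.Properties using (<-≤-trans; <⇒≤; m≤m+n; m≤n+m; +-mono-≤; *-monoˡ-≤)
open import Relation.Binary.PropositionalEquality using (_≡_; refl; sym; trans; cong₂; subst; subst₂)

agree-weaken : ∀ {m n α β} → m ≤ n → Agree n α β → Agree m α β
agree-weaken m≤n h i i<m = h i (<-≤-trans i<m m≤n)

_≗_ : Baire → Baire → Set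
α ≗ β = ∀ i → α i ≡ β i

Closed₁ : (Baire → Set) → Set
Closed₁ P = ∀ α → (∀ n → Σ Baire λ α' → Agree n α α' × P α') → P α

-- A closed set is extensional: a pointwise equal copy of a member is
-- a limit point of the set, hence a member.
closed₃-ext : ∀ {F : Rel₃} → Closed₃ F → ∀ {α β γ α' β' γ'} →
  α ≗ α' → β ≗ β' → γ ≗ γ' → F α β γ → F α' β' γ'
closed₃-ext {F} Fc {α} {β} {γ} {α'} {β'} {γ'} pα pβ pγ f =
  Fc α' β' γ' (λ _ → α , β , γ , (λ i _ → sym (pα i)) , (λ i _ → sym (pβ i)) , (λ i _ → sym (pγ i)) , f)

×-closed : ∀ {A B : Rel₂} → Closed₂ A → Closed₂ B → Closed₂ (λ α β → A α β × B α β)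
×-closed Ac Bc α β h =
  Ac α β (λ n → let (α' , β' , hα , hβ , a , _) = h n in α' , β' , hα , hβ , a) ,
  Bc α β (λ n → let (α' , β' , hα , hβ , _ , b) = h n in α' , β' , hα , hβ , b)

left-closed : ∀ {P : Baire → Set} → Closed₁ P → Closed₂ (λ α β → P α)
left-closed Pc α β h = Pc α (λ n → let (α' , _ , hα , _ , p) = h n in α' , hα , p)

right-closed : ∀ {P : Baire → Set} → Closed₁ P → Closed₂ (λ α β → P β)
right-closed Pc α β h = Pc β (λ n → let (_ , β' , _ , hβ , p) = h n in β' , hβ , p)

record Match (f g : ℕ → ℕ) (α β : Baire) : Set where
  constructor matching
  field matches : ∀ i → α (f i) ≡ β (g i)
open Match

match-sym : ∀ {f g α β} → Match f g α β → Match g f β α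
match-sym m = matching λ i → sym (matches m i)

-- Each equation α (f i) ≡ β (g i) only involves finitely many coordinates,
-- so it passes to limits.
match-closed : ∀ f g → Closed₂ (Match f g)
match-closed f g α β h = matching λ i →
  let (α' , β' , hα , hβ , e) = h (suc (f i + g i)) in
  trans (hα (f i) (s≤s (m≤m+n _ _))) (trans (matches e i) (sym (hβ (g i) (s≤s (m≤n+m _ _)))))

piecewise-closed : {Kind : Set} (κ : Baire → Kind) (m : ℕ) →
  (∀ {α α'} → Agree m α α' → κ α ≡ κ α') →
  (B : Kind → Kind → Rel₂) → (∀ k l → Closed₂ (B k l)) →
  Closed₂ (λ α β → B (κ α) (κ β) α β)
piecewise-closed κ m κ-local B Bc α β h = Bc (κ α) (κ β) α β approx
  where
  approx : ∀ n → Σ Baire λ α' → Σ Baire λ β' → Agree n α α' × Agree n β β' × B (κ α) (κ β) α' β'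
  approx n =
    let (α' , β' , hα , hβ , r) = h (n + m) in
    α' , β' , agree-weaken (m≤m+n n m) hα , agree-weaken (m≤m+n n m) hβ ,
    subst₂ (λ k l → B k l α' β')
      (sym (κ-local (agree-weaken (m≤n+m m n) hα))) (sym (κ-local (agree-weaken (m≤n+m m n) hβ))) r

-- Coding of triples.  After two tag coordinates, component j of the coded
-- triple occupies the coordinates slot j k = 2 + (j + 3k).
slot : ℕ → ℕ → ℕ
slot j k = 2 + (j + k * 3)

component : ℕ → Baire → Baire
component j c k = c (slot j k)

interleave : Baire → Baire → Baire → Baire
interleave α β γ zero = α 0
interleave α β γ (suc zero) = β 0
interleave α β γ (suc (suc zero)) = γ 0
interleave α β γ (suc (suc (suc m))) =
  interleave (λ i → α (suc i)) (λ i → β (suc i)) (λ i → γ (suc i)) m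

code : ℕ → Baire → Baire → Baire → Baire
code t α β γ zero = 0
code t α β γ (suc zero) = t
code t α β γ (suc (suc m)) = interleave α β γ m

component₀-code : ∀ t α β γ → component 0 (code t α β γ) ≗ α
component₀-code t α β γ zero = refl
component₀-code t α β γ (suc k) = component₀-code t _ _ _ k

component₁-code : ∀ t α β γ → component 1 (code t α β γ) ≗ β
component₁-code t α β γ zero = refl
component₁-code t α β γ (suc k) = component₁-code t _ _ _ k

component₂-code : ∀ t α β γ → component 2 (code t α β γ) ≗ γ
component₂-code t α β γ zero = refl
component₂-code t α β γ (suc k) = component₂-code t _ _ _ k

component-agree : ∀ j {m c c'} → j ≤ 2 → Agree (5 + m * 3) c c' → Agree m (component j c) (component j c')
component-agree j {m} j≤2 h i i<m =
  h (slot j i) (s≤s (s≤s (s≤s (+-mono-≤ j≤2 (*-monoˡ-≤ 3 (<⇒≤ i<m))))))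

Identical : Rel₂
Identical = Match (λ i → i) (λ i → i)

SamePayload : Rel₂
SamePayload = Match (2 +_) (2 +_)

identical⇒same-payload : ∀ {c d} → Identical c d → SamePayload c d
identical⇒same-payload e = matching λ i → matches e (2 + i)

same-payload-component : ∀ {c d} → SamePayload c d → ∀ j → component j c ≗ component j d
same-payload-component e j i = matches e (j + i * 3)

data Kind : Set where
  point left right : Kind

kind : ℕ → ℕ → Kind
kind (suc _) _ = point
kind zero zero = left
kind zero (suc _) = right

kind-of : Baire → Kind
kind-of α = kind (α 0) (α 1)

kind-of-local : ∀ {α α'} → Agree 2 α α' → kind-of α ≡ kind-of α'
kind-of-local h = cong₂ kind (h 0 (s≤s z≤n)) (h 1 (s≤s (s≤s z≤n)))

kind-of-X : ∀ α → InX α → kind-of α ≡ point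
kind-of-X α h with α 0
kind-of-X α (s≤s _) | suc _ = refl

module Construction (F : Rel₃) (Fc : Closed₃ F) where

  Coded : Baire → Set
  Coded c = F (component 0 c) (component 1 c) (component 2 c)

  coded-ext : ∀ {c d} → SamePayload c d → Coded c → Coded d
  coded-ext e = closed₃-ext Fc (same-payload-component e 0) (same-payload-component e 1) (same-payload-component e 2)

  code-coded : ∀ t {α β γ} → F α β γ → Coded (code t α β γ)
  code-coded t {α} {β} {γ} = closed₃-ext Fc
    (λ k → sym (component₀-code t α β γ k)) (λ k → sym (component₁-code t α β γ k)) (λ k → sym (component₂-code t α β γ k))

  coded-closed : Closed₁ Coded
  coded-closed c h = Fc (component 0 c) (component 1 c) (component 2 c) λ m →
    let (c' , hc , fd) = h (5 + m * 3) in
    component 0 c' , component 1 c' , component 2 c' ,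
    component-agree 0 z≤n hc , component-agree 1 (s≤s z≤n) hc , component-agree 2 (s≤s (s≤s z≤n)) hc , fd

  Body : Kind → Kind → Rel₂
  Body point point α β = Identical α β
  Body point left  α c = Coded c × Match (λ i → i) (slot 0) α c
  Body point right α c = Coded c × Match (λ i → i) (slot 1) α c
  Body left  point c β = Coded c × Match (slot 0) (λ i → i) c β
  Body right point c β = Coded c × Match (slot 1) (λ i → i) c β
  Body left  left  c d = Identical c d
  Body right right c d = Identical c d
  Body left  right c d = Coded c × SamePayload c d
  Body right left  c d = Coded c × SamePayload c d

  R : Rel₂
  R α β = Body (kind-of α) (kind-of β) α β

  body-closed : ∀ k l → Closed₂ (Body k l)
  body-closed point point = match-closed _ _
  body-closed point left  = ×-closed (right-closed coded-closed) (match-closed _ _)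
  body-closed point right = ×-closed (right-closed coded-closed) (match-closed _ _)
  body-closed left  point = ×-closed (left-closed coded-closed) (match-closed _ _)
  body-closed right point = ×-closed (left-closed coded-closed) (match-closed _ _)
  body-closed left  left  = match-closed _ _
  body-closed right right = match-closed _ _
  body-closed left  right = ×-closed (left-closed coded-closed) (match-closed _ _)
  body-closed right left  = ×-closed (left-closed coded-closed) (match-closed _ _)

  R-closed : Closed₂ R
  R-closed = piecewise-closed kind-of 2 kind-of-local Body body-closed

  R-reflexive : Reflexive₂ R
  R-reflexive α with kind-of α
  ... | point = matching λ _ → refl
  ... | left  = matching λ _ → refl
  ... | right = matching λ _ → refl

  body-sym : ∀ k l α β → Body k l α β → Body l k β α
  body-sym point point α β e = match-sym e
  body-sym point left  α β (cβ , e) = cβ , match-sym e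
  body-sym point right α β (cβ , e) = cβ , match-sym e
  body-sym left  point α β (cα , e) = cα , match-sym e
  body-sym right point α β (cα , e) = cα , match-sym e
  body-sym left  left  α β e = match-sym e
  body-sym right right α β e = match-sym e
  body-sym left  right α β (cα , e) = coded-ext e cα , match-sym e
  body-sym right left  α β (cα , e) = coded-ext e cα , match-sym e

  R-symmetric : Symmetric₂ R
  R-symmetric α β = body-sym (kind-of α) (kind-of β) α β

  module Projection (E : Rel₂) (E-equiv : EquivOnX E)
                    (E-proj : ∀ α β → (E α β → ∃ λ γ → F α β γ) × ((∃ λ γ → F α β γ) → E α β)) where

    E-sym : ∀ {α β} → E α β → E β α
    E-sym {α} {β} = proj₁ (proj₂ (proj₂ E-equiv)) α β

    E-trans : ∀ {α β γ} → E α β → E β γ → E α γ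
    E-trans {α} {β} {γ} = proj₂ (proj₂ (proj₂ E-equiv)) α β γ

    -- E is extensional, being the projection of the extensional set F.
    E-ext : ∀ {α β α'} → α ≗ α' → E α β → E α' β
    E-ext {α} {β} {α'} p e =
      let (γ , f) = proj₁ (E-proj α β) e in
      proj₂ (E-proj α' β) (γ , closed₃-ext Fc p (λ _ → refl) (λ _ → refl) f)

    coded-E : ∀ c → Coded c → E (component 0 c) (component 1 c)
    coded-E c cc = proj₂ (E-proj (component 0 c) (component 1 c)) (component 2 c , cc)

    -- Represents k x α: x (of kind k) stands for a point E-equivalent to α;
    -- a code stands for the first component of its triple.
    Represents : Kind → Baire → Baire → Set
    Represents point x α = E x α
    Represents left  c α = Coded c × E (component 0 c) α
    Represents right c α = Coded c × E (component 0 c) α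

    payload-preserves : ∀ c d α → SamePayload c d → Coded c × E (component 0 c) α → Coded d × E (component 0 d) α
    payload-preserves c d α e (cc , r) = coded-ext {c} {d} e cc , E-ext (same-payload-component e 0) r

    -- A step from a point to a
    -- right code, or back, passes between the two components of the triple,
    -- which are E-equivalent.
    body-preserves : ∀ k l x y α → Body k l x y → Represents k x α → Represents l y α
    body-preserves point point x y α e r = E-ext (matches e) r
    body-preserves point left  x c α (cc , e) r = cc , E-ext (matches e) r
    body-preserves point right x c α (cc , e) r = cc , E-trans (coded-E c cc) (E-ext (matches e) r)
    body-preserves left  point c y α (_ , e) (_ , r) = E-ext (matches e) r
    body-preserves right point c y α (cc , e) (_ , r) = E-ext (matches e) (E-trans (E-sym (coded-E c cc)) r)
    body-preserves left  left  c d α e r = payload-preserves c d α (identical⇒same-payload e) r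
    body-preserves right right c d α e r = payload-preserves c d α (identical⇒same-payload e) r
    body-preserves left  right c d α (_ , e) r = payload-preserves c d α e r
    body-preserves right left  c d α (_ , e) r = payload-preserves c d α e r

    pow-preserves : ∀ n x y α → RPow R n x y → Represents (kind-of x) x α → Represents (kind-of y) y α
    pow-preserves zero x y α r = body-preserves (kind-of x) (kind-of y) x y α r
    pow-preserves (suc n) x y α (z , rⁿ , r) rep =
      body-preserves (kind-of z) (kind-of y) z y α r (pow-preserves n x z α rⁿ rep)

    -- tc(R) ∩ X² ⊆ E: start the invariant at α with E α α and carry it to β.
    tc-sound : ∀ α β → tc R α β × (InX α × InX β) → E α β
    tc-sound α β ((n , rⁿ) , xα , xβ) =
      E-sym (subst (λ k → Represents k β α) (kind-of-X β xβ)
        (pow-preserves n α β α rⁿ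
          (subst (λ k → Represents k α α) (sym (kind-of-X α xα)) (proj₁ (proj₂ E-equiv) α xα))))

    -- E ⊆ tc(R): with a witness γ for E α β, the left and right codes of
    -- (α, β, γ) give the chain α R cₗ R cᵣ R β.
    tc-complete : ∀ α β → E α β → tc R α β
    tc-complete α β e = 2 , cᵣ , (cₗ , α-cₗ , cₗ-cᵣ) , cᵣ-β
      where
      γ = proj₁ (proj₁ (E-proj α β) e)
      xα = proj₁ (proj₁ E-equiv α β e)
      xβ = proj₂ (proj₁ E-equiv α β e)
      cₗ = code 0 α β γ
      cᵣ = code 1 α β γ
      cₗ-coded : Coded cₗ
      cₗ-coded = code-coded 0 (proj₂ (proj₁ (E-proj α β) e))
      α-cₗ : R α cₗ
      α-cₗ = subst (λ k → Body k left α cₗ) (sym (kind-of-X α xα))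
               (cₗ-coded , matching λ i → sym (component₀-code 0 α β γ i))
      cₗ-cᵣ : R cₗ cᵣ
      cₗ-cᵣ = cₗ-coded , matching λ _ → refl
      cᵣ-β : R cᵣ β
      cᵣ-β = subst (λ k → Body right k cᵣ β) (sym (kind-of-X β xβ))
               (cₗ-coded , matching (component₁-code 0 α β γ))

corollary1 : (E : Rel₂) → EquivOnX E → Analytic₂ E →
    Σ Rel₂ λ R → Closed₂ R × Reflexive₂ R × Symmetric₂ R ×
      (∀ α β → (E α β → tc R α β × (InX α × InX β)) × (tc R α β × (InX α × InX β) → E α β))
corollary1 E E-equiv (F , Fc , E-proj) =
  R , R-closed , R-reflexive , R-symmetric ,
  λ α β → (λ e → tc-complete α β e , proj₁ E-equiv α β e) , tc-sound α β
  where
  open Construction F Fc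
  open Projection E E-equiv E-proj
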